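{- Let $S$ be a sorting sequence of length $p$ with $r>1$ distinct values and multiplicities $p_1,\dots,p_r$, let $k\ge1$ and $f\ge0$, and let $\mathcal F$ be the set of all general solutions $(f_1,\dots,f_r)$ for $S$ with $f$ fake coins satisfying the height bound for $k$. If $\mathcal F\neq\emptyset$, the revealing factor of the sorting strategy with outcome $S$ and $f$ fake coins is \[X=\frac{\binom{pk}{f}}{\sum_{(f_1,\dots,f_r)\in\mathcal F}\prod_{i=1}^{r}\binom{k}{f_i}^{p_i}}.\]
   Context: There are $pk$ labelled coins in $p$ labelled piles of $k$ coins; each coin is real or fake, fake coins being lighter (all real coins of equal weight, all fake coins of equal weight). The sorting strategy sorts the piles by weight; the outcome is recorded by a sorting sequence of length $p$ — a non-decreasing sequence of non-negative integers beginning with $0$ in which each entry equals the previous one or exceeds it by $1$ — together with the assignment of piles to its entries (heaviest first; equal-weight piles equal entries, a strictly lighter pile an entry one larger). If the distinct entries are $0,\dots,r-1$, $p_i\ge1$ is the number of entries (piles) equal to $i-1$. A general solution with $f$ fake coins is an integer tuple $(f_1,\dots,f_r)$ with $0\le f_1<\dots<f_r$ and $\sum_i p_if_i=f$ ($f_i$ fake coins in each pile marked $i-1$); it satisfies the height bound for $k$ if $f_r\le k$. For a property $P$ (here: there are exactly $f$ fake coins), the old possibilities are the sets of fake coins among the $pk$ coins for which $P$ holds, the new possibilities are those which are moreover consistent with the outcome; when the number of new possibilities is nonzero, the revealing factor is (number of old possibilities)/(number of new possibilities). -}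

module Defs where

open import Data.Bool using (Bool; true; false)
open import Data.Nat using (ℕ; zero; suc; _+_; _*_; _^_; _≤_; _<_; _≟_; _<?_)
open import Data.Nat.Combinatorics using (_C_)
open import Data.Fin using (Fin; toℕ; inject₁)
open import Data.Fin.Permutation using (Permutation′; _⟨$⟩ʳ_)
open import Data.Fin.Properties using (all?)
open import Data.Vec using (Vec; []; _∷_; lookup; tabulate; count; last)
import Data.Vec as V
open import Data.List using (List; []; _∷_; [_]; concatMap; map; filter; length)
import Data.List as L
open import Data.Maybe using (Maybe; just; nothing)
open import Data.Product using (_×_; _,_)
open import Data.Sum using (_⊎_)
open import Data.Unit using (⊤)
open import Data.Empty using (⊥)
open import Data.Integer using (+_)
open import Data.Rational using (ℚ; _/_)
open import Relation.Binary.PropositionalEquality using (_≡_)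
open import Relation.Nullary using (Dec)
open import Relation.Nullary.Decidable using (_×-dec_; _→-dec_)

Steps : ∀ {n} → ℕ → Vec ℕ n → Set
Steps x []       = ⊤
Steps x (y ∷ ys) = (y ≡ x ⊎ y ≡ suc x) × Steps y ys

IsSortingSeq : ∀ {p} → Vec ℕ p → Set
IsSortingSeq []       = ⊥
IsSortingSeq (x ∷ xs) = x ≡ 0 × Steps x xs

-- the number of entries of S equal to v  (p_i = mult S (i-1))
mult : ∀ {p} → Vec ℕ p → ℕ → ℕ
mult S v = count (λ x → x ≟ v) S

-- General solutions (f₁,…,f_r), stored 0-indexed as fs : Vec ℕ r,
-- with lookup fs i = f_{i+1}, the number of fake coins in each pile
-- marked i.

StrictlyIncreasing : ∀ {r} → Vec ℕ r → Set
StrictlyIncreasing {r} fs =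
  (i j : Fin r) → toℕ i < toℕ j → lookup fs i < lookup fs j

weightedSum : ∀ {p r} → Vec ℕ p → Vec ℕ r → ℕ
weightedSum S fs = V.sum (tabulate (λ i → mult S (toℕ i) * lookup fs i))

IsGeneralSolution : ∀ {p r} → Vec ℕ p → ℕ → Vec ℕ r → Set
IsGeneralSolution S f fs = StrictlyIncreasing fs × weightedSum S fs ≡ f

HeightBound : ∀ {r} → ℕ → Vec ℕ r → Set
HeightBound {zero}  k fs = ⊤
HeightBound {suc r} k fs = last fs ≤ k

solutionWeight : ∀ {p r} → Vec ℕ p → ℕ → Vec ℕ r → ℕ
solutionWeight S k fs =
  V.foldr _ _*_ 1 (tabulate (λ i → (k C lookup fs i) ^ mult S (toℕ i)))

-- The coins are labelled (j , c) with j : Fin p the pile and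
-- c : Fin k the position inside the pile.  A possibility (set of fake
-- coins) is given by its indicator  g : Vec (Vec Bool k) p,
-- where lookup (lookup g j) c = true  iff coin (j , c) is fake.

vecsOver : ∀ {A : Set} → List A → (n : ℕ) → List (Vec A n)
vecsOver xs zero    = [ [] ]
vecsOver xs (suc n) = concatMap (λ v → map (λ x → x ∷ v) xs) (vecsOver xs n)

allPossibilities : (p k : ℕ) → List (Vec (Vec Bool k) p)
allPossibilities p k = vecsOver (vecsOver (true ∷ false ∷ []) k) p

fakesInPile : ∀ {k} → Vec Bool k → ℕ
fakesInPile v = count (λ b → b Data.Bool.≟ true) v

totalFakes : ∀ {p k} → Vec (Vec Bool k) p → ℕ
totalFakes g = V.sum (V.map fakesInPile g)

-- The outcome of the sorting strategy: a sorting sequence S together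
-- with an assignment σ of the piles to its entries (pile j gets the
-- entry at position σ j).  Pile j with c_j fake coins weighs
-- (k - c_j)·w_real + c_j·w_fake, which is strictly decreasing in c_j,
-- so a set of fake coins is consistent with the outcome iff
-- equal entries ↔ equal fake counts, larger entry (lighter) ↔ more fakes.
entry : ∀ {p} → Vec ℕ p → Permutation′ p → Fin p → ℕ
entry S σ j = lookup S (σ ⟨$⟩ʳ j)

Consistent : ∀ {p k} → Vec ℕ p → Permutation′ p → Vec (Vec Bool k) p → Set
Consistent {p} S σ g = (j j′ : Fin p) →
  ((entry S σ j ≡ entry S σ j′) → fakesInPile (lookup g j) ≡ fakesInPile (lookup g j′))
  × ((entry S σ j < entry S σ j′) → fakesInPile (lookup g j) < fakesInPile (lookup g j′))

consistent? : ∀ {p k} (S : Vec ℕ p) (σ : Permutation′ p) (g : Vec (Vec Bool k) p) →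
  Dec (Consistent S σ g)
consistent? S σ g = all? (λ j → all? (λ j′ →
  ((entry S σ j ≟ entry S σ j′) →-dec (fakesInPile (lookup g j) ≟ fakesInPile (lookup g j′)))
  ×-dec ((entry S σ j <? entry S σ j′) →-dec (fakesInPile (lookup g j) <? fakesInPile (lookup g j′)))))

oldPossibilities : (p k f : ℕ) → ℕ
oldPossibilities p k f = length (filter (λ g → totalFakes g ≟ f) (allPossibilities p k))

newPossibilities : ∀ {p} (k f : ℕ) → Vec ℕ p → Permutation′ p → ℕ
newPossibilities {p} k f S σ =
  length (filter (λ g → (totalFakes g ≟ f) ×-dec consistent? S σ g) (allPossibilities p k))

ratio : ℕ → ℕ → Maybe ℚ
ratio a zero    = nothing
ratio a (suc b) = just ((+ a) / suc b)

revealingFactor : ∀ {p} (k f : ℕ) → Vec ℕ p → Permutation′ p → Maybe ℚ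
revealingFactor {p} k f S σ = ratio (oldPossibilities p k f) (newPossibilities k f S σ)

module Submission where

-- A vector c of fake counts per pile is realised by Π_j (k choose c_j) possibilities,
-- since a pile of k coins has (k choose c) patterns with c fake coins (Pascal's rule).
-- Flattening the p piles into one row of pk coins gives (pk choose f) old possibilities.
-- A count vector is consistent with the outcome iff it is constant on piles with equal
-- entry and strictly increasing in the entry, i.e. iff c_j = f_(entry of pile j) for a
-- general solution, the height bound being c_j ≤ k; as every value 0, …, r-1 occurs in S
-- this is a bijection onto 𝓕.  Grouping the piles by entry turns Σ_j c_j into
-- Σ_i p_i f_i and Π_j (k choose c_j) into Π_i (k choose f_i)^(p_i).  The new count is a
-- sum of positive terms over 𝓕 ≠ [], so the ratio is defined.


open import Defs
open import Algebra.Bundles using (CommutativeMonoid)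
open import Data.Bool using (Bool; true; false; if_then_else_)
open import Data.Empty using (⊥-elim)
open import Data.Fin using (Fin; toℕ; fromℕ; fromℕ<) renaming (zero to fzero; suc to fsuc)
open import Data.Fin.Permutation using (Permutation′; _⟨$⟩ʳ_; _⟨$⟩ˡ_; inverseʳ)
open import Data.Fin.Properties using (toℕ-injective; toℕ-fromℕ<; ≤fromℕ; toℕ<n; all?)
open import Data.List using (List; []; _∷_; map; concatMap; cartesianProductWith; filter; length; applyUpTo; upTo) renaming (_++_ to _++ᴸ_)
import Data.List.Properties as Listₚ
open import Data.List.Membership.Propositional using (_∈_; _∉_)
open import Data.List.Membership.Propositional.Properties using (∈-upTo⁺; ∈-upTo⁻; ∈-cartesianProductWith⁺; ∈-cartesianProductWith⁻)
open import Data.List.Relation.Unary.All as All using ([])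
open import Data.List.Relation.Unary.AllPairs using ([]; _∷_)
open import Data.List.Relation.Unary.Any using (here; there)
open import Data.List.Relation.Unary.Unique.Propositional using (Unique)
open import Data.List.Relation.Unary.Unique.Propositional.Properties using (upTo⁺; cartesianProductWith⁺)
open import Data.Maybe using (just)
open import Data.Nat using (ℕ; zero; suc; _+_; _*_; _^_; _≤_; _<_; _>_; _≟_; _<?_; z≤n; s≤s; s≤s⁻¹; +-0-rawMonoid)
open import Data.Nat.Combinatorics using (_C_; nCk+nC[k+1]≡[n+1]C[k+1]; k>n⇒nCk≡0)
open import Data.Nat.ListAction using (sum)
open import Data.Nat.ListAction.Properties using (sum-++)
open import Data.Nat.Properties
open import Data.Product using (Σ; _×_; _,_; swap; proj₁; proj₂; ∃; ∃-syntax)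
open import Data.Rational using (ℚ)
open import Data.Sum using (inj₁; inj₂)
open import Data.Unit using (tt)
open import Data.Vec using (Vec; []; _∷_; lookup; last; _++_; concat)
import Data.Vec as V
open import Data.Vec.Properties using (≡-dec; ∷-injective; tabulate-cong; tabulate∘lookup; lookup∘tabulate; tabulate-∘; lookup-map)
open import Function.Bundles using (_⇔_; mk⇔; Equivalence)
open import Relation.Binary using (DecidableEquality)
open import Relation.Binary.PropositionalEquality using (_≡_; _≢_; refl; sym; trans; cong; cong₂; subst; subst₂; module ≡-Reasoning)
open import Relation.Nullary using (Dec; yes; no; does; ¬_)
open import Relation.Nullary.Decidable using (does-⇔; dec-true; dec-false; _×-dec_; _→-dec_)
open import Relation.Unary using (Decidable)

open import Algebra.Properties.CommutativeSemigroup +-commutativeSemigroup using ()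
  renaming (interchange to +-interchange; x∙yz≈y∙xz to x+[y+z]≡y+[x+z])
open import Algebra.Properties.CommutativeSemigroup *-commutativeSemigroup using ()
  renaming (x∙yz≈yx∙z to x*[y*z]≡y*x*z)
open import Algebra.Definitions.RawMonoid +-0-rawMonoid using () renaming (_×_ to _×₊_)
open import Algebra.Definitions.RawMonoid *-1-rawMonoid using () renaming (_×_ to _×*_)

𝟙 : ∀ {P : Set} → Dec P → ℕ
𝟙 P? = if does P? then 1 else 0

module _ {P : Set} where

  𝟙-yes : (P? : Dec P) → P → 𝟙 P? ≡ 1
  𝟙-yes P? p = cong (if_then 1 else 0) (dec-true P? p)

  𝟙-no : (P? : Dec P) → ¬ P → 𝟙 P? ≡ 0
  𝟙-no P? ¬p = cong (if_then 1 else 0) (dec-false P? ¬p)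

𝟙-⇔ : {P Q : Set} → P ⇔ Q → (P? : Dec P) (Q? : Dec Q) → 𝟙 P? ≡ 𝟙 Q?
𝟙-⇔ P⇔Q P? Q? = cong (if_then 1 else 0) (does-⇔ P⇔Q P? Q?)

-- Grouping the piles by their entry

module GroupByValue {c ℓ} (M : CommutativeMonoid c ℓ) where

  open CommutativeMonoid M
    using (Carrier; _≈_; _∙_; ε; setoid; ∙-cong; ∙-congʳ; identityˡ; identityʳ)
    renaming (sym to ≈-sym; trans to ≈-trans)
  open import Algebra.Properties.CommutativeMonoid.Sum M
    using (sum-syntax; ∑-permute; sum-cong-≋; sum-replicate-zero)
    renaming (∑-distrib-+ to ∑-distrib-∙)
  open import Algebra.Definitions.RawMonoid (CommutativeMonoid.rawMonoid M) using () renaming (_×_ to _×ᴹ_)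
  open import Relation.Binary.Reasoning.Setoid setoid

  foldr-tabulate : ∀ {n} (g : Fin n → Carrier) → V.foldr _ _∙_ ε (V.tabulate g) ≡ ∑[ i < n ] g i
  foldr-tabulate {zero}  g = refl
  foldr-tabulate {suc n} g = cong (g fzero ∙_) (foldr-tabulate (λ i → g (fsuc i)))

  ∑-pickValue : ∀ {r} (a : ℕ → Carrier) {x} → x < r → ∑[ i < r ] (𝟙 (x ≟ toℕ i) ×ᴹ a (toℕ i)) ≈ a x
  ∑-pickValue {suc r} a {zero}  _ = begin
    (a 0 ∙ ε) ∙ ∑[ i < r ] ε ≈⟨ ∙-cong (identityʳ (a 0)) (sum-replicate-zero r) ⟩
    a 0 ∙ ε                  ≈⟨ identityʳ (a 0) ⟩
    a 0                      ∎
  ∑-pickValue {suc r} a {suc x} (s≤s x<r) = ≈-trans (identityˡ _) (∑-pickValue (λ n → a (suc n)) x<r)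

  ∑-groupByValue : ∀ {p r} (S : Vec ℕ p) → (∀ j → lookup S j < r) → (a : ℕ → Carrier) →
                   ∑[ j < p ] a (lookup S j) ≈ ∑[ i < r ] (mult S (toℕ i) ×ᴹ a (toℕ i))
  ∑-groupByValue {r = r} []      _    a = ≈-sym (sum-replicate-zero r)
  ∑-groupByValue {r = r} (x ∷ S) S<r a = begin
    a x ∙ ∑[ j < _ ] a (lookup S j)
      ≈⟨ ∙-cong (≈-sym (∑-pickValue {r} a (S<r fzero))) (∑-groupByValue S (λ j → S<r (fsuc j)) a) ⟩
    ∑[ i < r ] (𝟙 (x ≟ toℕ i) ×ᴹ a (toℕ i)) ∙ ∑[ i < r ] (mult S (toℕ i) ×ᴹ a (toℕ i))
      ≈⟨ ≈-sym (∑-distrib-∙ {r} (λ i → 𝟙 (x ≟ toℕ i) ×ᴹ a (toℕ i)) (λ i → mult S (toℕ i) ×ᴹ a (toℕ i))) ⟩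
    ∑[ i < r ] (𝟙 (x ≟ toℕ i) ×ᴹ a (toℕ i) ∙ mult S (toℕ i) ×ᴹ a (toℕ i))
      ≈⟨ sum-cong-≋ {r} (λ i → mult-∷ (toℕ i)) ⟩
    ∑[ i < r ] (mult (x ∷ S) (toℕ i) ×ᴹ a (toℕ i)) ∎
    where
    mult-∷ : ∀ v → 𝟙 (x ≟ v) ×ᴹ a v ∙ mult S v ×ᴹ a v ≈ mult (x ∷ S) v ×ᴹ a v
    mult-∷ v with does (x ≟ v)
    ... | true  = ∙-congʳ (identityʳ (a v))
    ... | false = identityˡ _

  foldr-groupByValue : ∀ {p r} (S : Vec ℕ p) (σ : Permutation′ p) → (∀ j → lookup S j < r) →
    (a : ℕ → Carrier) →
    V.foldr _ _∙_ ε (V.tabulate (λ j → a (entry S σ j))) ≈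
    V.foldr _ _∙_ ε (V.tabulate {n = r} (λ i → mult S (toℕ i) ×ᴹ a (toℕ i)))
  foldr-groupByValue {p} {r} S σ S<r a = begin
    V.foldr _ _∙_ ε (V.tabulate (λ j → a (entry S σ j)))  ≡⟨ foldr-tabulate (λ j → a (entry S σ j)) ⟩
    ∑[ j < p ] a (entry S σ j)                            ≈⟨ ≈-sym (∑-permute (λ j → a (lookup S j)) σ) ⟩
    ∑[ j < p ] a (lookup S j)                             ≈⟨ ∑-groupByValue S S<r a ⟩
    ∑[ i < r ] (mult S (toℕ i) ×ᴹ a (toℕ i))              ≡⟨ foldr-tabulate {r} (λ i → mult S (toℕ i) ×ᴹ a (toℕ i)) ⟨
    V.foldr _ _∙_ ε (V.tabulate {n = r} (λ i → mult S (toℕ i) ×ᴹ a (toℕ i))) ∎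

×₊≡* : ∀ m b → m ×₊ b ≡ m * b
×₊≡* zero    b = refl
×₊≡* (suc m) b = cong (b +_) (×₊≡* m b)

×*≡^ : ∀ m b → m ×* b ≡ b ^ m
×*≡^ zero    b = refl
×*≡^ (suc m) b = cong (b *_) (×*≡^ m b)

∏ : ∀ {n} → Vec ℕ n → ℕ
∏ = V.foldr _ _*_ 1

module _ {p r : ℕ} (S : Vec ℕ p) (σ : Permutation′ p) (S<r : ∀ j → lookup S j < r) (a : ℕ → ℕ) where

  sum-groupByValue : V.sum (V.tabulate (λ j → a (entry S σ j))) ≡
                     V.sum (V.tabulate {n = r} (λ i → mult S (toℕ i) * a (toℕ i)))
  sum-groupByValue = trans (GroupByValue.foldr-groupByValue +-0-commutativeMonoid S σ S<r a)
                           (cong V.sum (tabulate-cong {n = r} (λ i → ×₊≡* (mult S (toℕ i)) (a (toℕ i)))))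

  ∏-groupByValue : ∏ (V.tabulate (λ j → a (entry S σ j))) ≡
                   ∏ (V.tabulate {n = r} (λ i → a (toℕ i) ^ mult S (toℕ i)))
  ∏-groupByValue = trans (GroupByValue.foldr-groupByValue *-1-commutativeMonoid S σ S<r a)
                         (cong ∏ (tabulate-cong {n = r} (λ i → ×*≡^ (mult S (toℕ i)) (a (toℕ i)))))

open ≡-Reasoning

infixl 10 ∑-syntax

∑-syntax : {A : Set} → List A → (A → ℕ) → ℕ
∑-syntax xs f = sum (map f xs)

syntax ∑-syntax xs (λ x → e) = ∑[ x ← xs ] e

module _ {A : Set} where

  ∑-cong-∈ : (xs : List A) {f g : A → ℕ} → (∀ {x} → x ∈ xs → f x ≡ g x) →
             ∑[ x ← xs ] f x ≡ ∑[ x ← xs ] g x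
  ∑-cong-∈ []       eq = refl
  ∑-cong-∈ (x ∷ xs) eq = cong₂ _+_ (eq (here refl)) (∑-cong-∈ xs (λ x∈ → eq (there x∈)))

  ∑-cong : (xs : List A) {f g : A → ℕ} → (∀ x → f x ≡ g x) →
           ∑[ x ← xs ] f x ≡ ∑[ x ← xs ] g x
  ∑-cong xs eq = ∑-cong-∈ xs (λ {x} _ → eq x)

  ∑-zero : (xs : List A) {f : A → ℕ} → (∀ {x} → x ∈ xs → f x ≡ 0) → ∑[ x ← xs ] f x ≡ 0
  ∑-zero [] eq = refl
  ∑-zero (x ∷ xs) eq = cong₂ _+_ (eq (here refl)) (∑-zero xs (λ x∈ → eq (there x∈)))

  ∑-distrib-+ : (xs : List A) (f g : A → ℕ) →
                ∑[ x ← xs ] (f x + g x) ≡ ∑[ x ← xs ] f x + ∑[ x ← xs ] g x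
  ∑-distrib-+ []       f g = refl
  ∑-distrib-+ (x ∷ xs) f g = begin
    f x + g x + ∑[ y ← xs ] (f y + g y)                   ≡⟨ cong (f x + g x +_) (∑-distrib-+ xs f g) ⟩
    f x + g x + (∑[ y ← xs ] f y + ∑[ y ← xs ] g y)       ≡⟨ +-interchange (f x) (g x) _ _ ⟩
    f x + ∑[ y ← xs ] f y + (g x + ∑[ y ← xs ] g y)       ∎

  *-distribˡ-∑ : (a : ℕ) (xs : List A) (f : A → ℕ) → a * ∑[ x ← xs ] f x ≡ ∑[ x ← xs ] (a * f x)
  *-distribˡ-∑ a []       f = *-zeroʳ a
  *-distribˡ-∑ a (x ∷ xs) f = trans (*-distribˡ-+ a (f x) _) (cong (a * f x +_) (*-distribˡ-∑ a xs f))

  ∑-++ : (xs ys : List A) (f : A → ℕ) → ∑[ x ← xs ++ᴸ ys ] f x ≡ ∑[ x ← xs ] f x + ∑[ x ← ys ] f x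
  ∑-++ xs ys f = trans (cong sum (Listₚ.map-++ f xs ys)) (sum-++ (map f xs) (map f ys))

  length-filter≡∑𝟙 : {P : A → Set} (P? : Decidable P) (xs : List A) →
                     length (filter P? xs) ≡ ∑[ x ← xs ] 𝟙 (P? x)
  length-filter≡∑𝟙 P? []       = refl
  length-filter≡∑𝟙 P? (x ∷ xs) with does (P? x)
  ... | true  = cong suc (length-filter≡∑𝟙 P? xs)
  ... | false = length-filter≡∑𝟙 P? xs

  ∑-pick-∉ : (_≟ᴬ_ : DecidableEquality A) {xs : List A} {a : A} → a ∉ xs →
             (f : A → ℕ) → ∑[ x ← xs ] (f x * 𝟙 (x ≟ᴬ a)) ≡ 0
  ∑-pick-∉ _≟ᴬ_ {xs} {a} a∉ f = ∑-zero xs (λ {x} x∈ →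
    trans (cong (f x *_) (𝟙-no (x ≟ᴬ a) (λ { refl → a∉ x∈ }))) (*-zeroʳ (f x)))

  ∑-pick : (_≟ᴬ_ : DecidableEquality A) {xs : List A} → Unique xs → ∀ {a} → a ∈ xs →
           (f : A → ℕ) → ∑[ x ← xs ] (f x * 𝟙 (x ≟ᴬ a)) ≡ f a
  ∑-pick _≟ᴬ_ {a ∷ xs} (a∉xs ∷ _) (here refl) f = begin
    f a * 𝟙 (a ≟ᴬ a) + ∑[ x ← xs ] (f x * 𝟙 (x ≟ᴬ a))
      ≡⟨ cong₂ (λ s t → f a * s + t) (𝟙-yes (a ≟ᴬ a) refl) (∑-pick-∉ _≟ᴬ_ (λ a∈ → All.lookup a∉xs a∈ refl) f) ⟩
    f a * 1 + 0
      ≡⟨ trans (+-identityʳ (f a * 1)) (*-identityʳ (f a)) ⟩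
    f a ∎
  ∑-pick _≟ᴬ_ {y ∷ xs} (y∉xs ∷ xs!) {a} (there a∈) f = begin
    f y * 𝟙 (y ≟ᴬ a) + ∑[ x ← xs ] (f x * 𝟙 (x ≟ᴬ a))
      ≡⟨ cong (λ t → f y * t + ∑[ x ← xs ] (f x * 𝟙 (x ≟ᴬ a))) (𝟙-no (y ≟ᴬ a) (All.lookup y∉xs a∈)) ⟩
    f y * 0 + ∑[ x ← xs ] (f x * 𝟙 (x ≟ᴬ a))
      ≡⟨ cong (_+ ∑[ x ← xs ] (f x * 𝟙 (x ≟ᴬ a))) (*-zeroʳ (f y)) ⟩
    ∑[ x ← xs ] (f x * 𝟙 (x ≟ᴬ a))
      ≡⟨ ∑-pick _≟ᴬ_ xs! a∈ f ⟩
    f a ∎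

  0<∑ : (xs : List A) {f : A → ℕ} → xs ≢ [] → (∀ {x} → x ∈ xs → 0 < f x) → 0 < ∑[ x ← xs ] f x
  0<∑ []       xs≢[] _   = ⊥-elim (xs≢[] refl)
  0<∑ (x ∷ xs) {f} _ 0<f = <-≤-trans (0<f (here refl)) (m≤m+n (f x) (∑[ y ← xs ] f y))

module _ {A B : Set} where

  ∑-map : (h : A → B) (xs : List A) (f : B → ℕ) → ∑[ y ← map h xs ] f y ≡ ∑[ x ← xs ] f (h x)
  ∑-map h xs f = cong sum (sym (Listₚ.map-∘ xs))

  ∑-concatMap : (h : A → List B) (xs : List A) (f : B → ℕ) →
                ∑[ y ← concatMap h xs ] f y ≡ ∑[ x ← xs ] ∑[ y ← h x ] f y
  ∑-concatMap h []       f = refl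
  ∑-concatMap h (x ∷ xs) f = trans (∑-++ (h x) (concatMap h xs) f) (cong (∑[ y ← h x ] f y +_) (∑-concatMap h xs f))

  ∑-comm : (xs : List A) (ys : List B) (f : A → B → ℕ) →
           ∑[ x ← xs ] ∑[ y ← ys ] f x y ≡ ∑[ y ← ys ] ∑[ x ← xs ] f x y
  ∑-comm []       ys f = sym (∑-zero ys (λ _ → refl))
  ∑-comm (x ∷ xs) ys f = trans (cong (∑[ y ← ys ] f x y +_) (∑-comm xs ys f)) (sym (∑-distrib-+ ys (f x) _))

-- Write g x · [Q x] as Σ_y g (h y) · [x = h y] and exchange the two sums.
module _ {A B : Set} (_≟ᴬ_ : DecidableEquality A) (_≟ᴮ_ : DecidableEquality B) where

  ∑-filter-bijection : {Q : A → Set} (Q? : Decidable Q) {xs : List A} {ys : List B} (h : B → A) (g : A → ℕ) →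
    Unique xs → Unique ys → (∀ {y y′} → h y ≡ h y′ → y ≡ y′) →
    (∀ {y} → y ∈ ys → h y ∈ xs × Q (h y)) →
    (∀ {x} → x ∈ xs → Q x → ∃[ y ] y ∈ ys × x ≡ h y) →
    ∑[ x ← xs ] (g x * 𝟙 (Q? x)) ≡ ∑[ y ← ys ] g (h y)
  ∑-filter-bijection {Q} Q? {xs} {ys} h g xs! ys! h-inj into onto = begin
    ∑[ x ← xs ] (g x * 𝟙 (Q? x))
      ≡⟨ ∑-cong-∈ xs (λ x∈ → termwise x∈ (Q? _)) ⟩
    ∑[ x ← xs ] ∑[ y ← ys ] (g (h y) * 𝟙 (x ≟ᴬ h y))
      ≡⟨ ∑-comm xs ys (λ x y → g (h y) * 𝟙 (x ≟ᴬ h y)) ⟩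
    ∑[ y ← ys ] ∑[ x ← xs ] (g (h y) * 𝟙 (x ≟ᴬ h y))
      ≡⟨ ∑-cong-∈ ys (λ {y} y∈ → ∑-pick _≟ᴬ_ xs! (proj₁ (into y∈)) (λ _ → g (h y))) ⟩
    ∑[ y ← ys ] g (h y) ∎
    where
    termwise : ∀ {x} → x ∈ xs → (Q?x : Dec (Q x)) → g x * 𝟙 Q?x ≡ ∑[ y ← ys ] (g (h y) * 𝟙 (x ≟ᴬ h y))
    termwise x∈ (yes q) with y₀ , y₀∈ , refl ← onto x∈ q = begin
      g (h y₀) * 1
        ≡⟨ *-identityʳ _ ⟩
      g (h y₀)
        ≡⟨ ∑-pick _≟ᴮ_ ys! y₀∈ (λ y → g (h y)) ⟨
      ∑[ y ← ys ] (g (h y) * 𝟙 (y ≟ᴮ y₀))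
        ≡⟨ ∑-cong ys (λ y → cong (g (h y) *_) (𝟙-⇔ (mk⇔ (λ { refl → refl }) (λ eq → sym (h-inj eq))) (y ≟ᴮ y₀) (h y₀ ≟ᴬ h y))) ⟩
      ∑[ y ← ys ] (g (h y) * 𝟙 (h y₀ ≟ᴬ h y)) ∎
    termwise {x} x∈ (no ¬q) = trans (*-zeroʳ (g x)) (sym (∑-zero ys (λ {y} y∈ →
      trans (cong (g (h y) *_) (𝟙-no (x ≟ᴬ h y) (λ { refl → ¬q (proj₂ (into y∈)) }))) (*-zeroʳ (g (h y))))))

∑-upTo-suc : ∀ n (f : ℕ → ℕ) → ∑[ a ← upTo (suc n) ] f a ≡ f 0 + ∑[ a ← upTo n ] f (suc a)
∑-upTo-suc n f = cong (f 0 +_) (begin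
  ∑[ a ← applyUpTo suc n ] f a        ≡⟨ cong (λ as → sum (map f as)) (Listₚ.map-applyUpTo (λ a → a) suc n) ⟨
  ∑[ a ← map suc (upTo n) ] f a       ≡⟨ ∑-map suc (upTo n) f ⟩
  ∑[ a ← upTo n ] f (suc a)           ∎)

concatMap-map≡cartesianProductWith : {A B C : Set} (g : A → B → C) (xs : List A) (ys : List B) →
  concatMap (λ x → map (g x) ys) xs ≡ cartesianProductWith g xs ys
concatMap-map≡cartesianProductWith g []       ys = refl
concatMap-map≡cartesianProductWith g (x ∷ xs) ys =
  cong (map (g x) ys ++ᴸ_) (concatMap-map≡cartesianProductWith g xs ys)

module _ {A : Set} where

  vecsOver-suc : (L : List A) (n : ℕ) →
                 vecsOver L (suc n) ≡ cartesianProductWith (λ v x → x ∷ v) (vecsOver L n) L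
  vecsOver-suc L n = concatMap-map≡cartesianProductWith (λ v x → x ∷ v) (vecsOver L n) L

  ∈-vecsOver⁺ : (L : List A) {n : ℕ} {v : Vec A n} → (∀ j → lookup v j ∈ L) → v ∈ vecsOver L n
  ∈-vecsOver⁺ L {v = []}    _  = here refl
  ∈-vecsOver⁺ L {v = x ∷ v} v⊆L = subst (x ∷ v ∈_) (sym (vecsOver-suc L _))
    (∈-cartesianProductWith⁺ (λ v x → x ∷ v) (∈-vecsOver⁺ L (λ j → v⊆L (fsuc j))) (v⊆L fzero))

  ∈-vecsOver⁻ : (L : List A) {n : ℕ} {v : Vec A n} → v ∈ vecsOver L n → ∀ j → lookup v j ∈ L
  ∈-vecsOver⁻ L {suc n} v∈ j
    with _ , _ , w∈ , x∈ , refl ← ∈-cartesianProductWith⁻ (λ v x → x ∷ v) (vecsOver L n) L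
                                    (subst (_ ∈_) (vecsOver-suc L n) v∈)
    with j
  ... | fzero  = x∈
  ... | fsuc j = ∈-vecsOver⁻ L w∈ j

  vecsOver-unique : {L : List A} → Unique L → ∀ n → Unique (vecsOver L n)
  vecsOver-unique L! zero    = [] ∷ []
  vecsOver-unique L! (suc n) = subst Unique (sym (vecsOver-suc _ n))
    (cartesianProductWith⁺ (λ v x → x ∷ v) (λ eq → swap (∷-injective eq)) (vecsOver-unique L! n) L!)

  ∑-vecsOver-suc : (L : List A) (n : ℕ) (φ : Vec A (suc n) → ℕ) →
                   ∑[ v ← vecsOver L (suc n) ] φ v ≡ ∑[ v ← vecsOver L n ] ∑[ x ← L ] φ (x ∷ v)
  ∑-vecsOver-suc L n φ = trans (∑-concatMap (λ v → map (_∷ v) L) (vecsOver L n) φ)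
                               (∑-cong (vecsOver L n) (λ v → ∑-map (_∷ v) L φ))

  ∑-vecsOver-++ : (L : List A) (m n : ℕ) (φ : Vec A (m + n) → ℕ) →
                  ∑[ w ← vecsOver L (m + n) ] φ w ≡ ∑[ v ← vecsOver L n ] ∑[ u ← vecsOver L m ] φ (u ++ v)
  ∑-vecsOver-++ L zero    n φ = ∑-cong (vecsOver L n) (λ v → sym (+-identityʳ (φ v)))
  ∑-vecsOver-++ L (suc m) n φ = begin
    ∑[ w ← vecsOver L (suc m + n) ] φ w
      ≡⟨ ∑-vecsOver-suc L (m + n) φ ⟩
    ∑[ w ← vecsOver L (m + n) ] ∑[ x ← L ] φ (x ∷ w)
      ≡⟨ ∑-vecsOver-++ L m n (λ w → ∑[ x ← L ] φ (x ∷ w)) ⟩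
    ∑[ v ← vecsOver L n ] ∑[ u ← vecsOver L m ] ∑[ x ← L ] φ (x ∷ u ++ v)
      ≡⟨ ∑-cong (vecsOver L n) (λ v → sym (∑-vecsOver-suc L m (λ u → φ (u ++ v)))) ⟩
    ∑[ v ← vecsOver L n ] ∑[ u ← vecsOver L (suc m) ] φ (u ++ v) ∎

∑-vecsOver-concat : {A : Set} (L : List A) (k p : ℕ) (φ : Vec A (p * k) → ℕ) →
                    ∑[ g ← vecsOver (vecsOver L k) p ] φ (concat g) ≡ ∑[ w ← vecsOver L (p * k) ] φ w
∑-vecsOver-concat L k zero    φ = refl
∑-vecsOver-concat L k (suc p) φ = begin
  ∑[ g ← vecsOver (vecsOver L k) (suc p) ] φ (concat g)
    ≡⟨ ∑-vecsOver-suc (vecsOver L k) p (λ g → φ (concat g)) ⟩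
  ∑[ g ← vecsOver (vecsOver L k) p ] ∑[ u ← vecsOver L k ] φ (u ++ concat g)
    ≡⟨ ∑-vecsOver-concat L k p (λ v → ∑[ u ← vecsOver L k ] φ (u ++ v)) ⟩
  ∑[ v ← vecsOver L (p * k) ] ∑[ u ← vecsOver L k ] φ (u ++ v)
    ≡⟨ sym (∑-vecsOver-++ L k (p * k) φ) ⟩
  ∑[ w ← vecsOver L (suc p * k) ] φ w ∎

∑-vecsOver-map : {A B : Set} (L : List A) (t : A → B) (M : List B) (w : B → ℕ) →
  (∀ ψ → ∑[ x ← L ] ψ (t x) ≡ ∑[ b ← M ] (w b * ψ b)) →
  ∀ p (φ : Vec B p → ℕ) → ∑[ g ← vecsOver L p ] φ (V.map t g) ≡ ∑[ c ← vecsOver M p ] (∏ (V.map w c) * φ c)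
∑-vecsOver-map L t M w fibre zero    φ = cong (_+ 0) (sym (*-identityˡ (φ [])))
∑-vecsOver-map L t M w fibre (suc p) φ = begin
  ∑[ g ← vecsOver L (suc p) ] φ (V.map t g)
    ≡⟨ ∑-vecsOver-suc L p (λ g → φ (V.map t g)) ⟩
  ∑[ g ← vecsOver L p ] ∑[ x ← L ] φ (t x ∷ V.map t g)
    ≡⟨ ∑-vecsOver-map L t M w fibre p (λ c → ∑[ x ← L ] φ (t x ∷ c)) ⟩
  ∑[ c ← vecsOver M p ] (∏ (V.map w c) * ∑[ x ← L ] φ (t x ∷ c))
    ≡⟨ ∑-cong (vecsOver M p) (λ c → cong (∏ (V.map w c) *_) (fibre (λ b → φ (b ∷ c)))) ⟩
  ∑[ c ← vecsOver M p ] (∏ (V.map w c) * ∑[ b ← M ] (w b * φ (b ∷ c)))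
    ≡⟨ ∑-cong (vecsOver M p) (λ c → trans (*-distribˡ-∑ (∏ (V.map w c)) M (λ b → w b * φ (b ∷ c)))
                                        (∑-cong M (λ b → x*[y*z]≡y*x*z (∏ (V.map w c)) (w b) (φ (b ∷ c))))) ⟩
  ∑[ c ← vecsOver M p ] ∑[ b ← M ] (∏ (V.map w (b ∷ c)) * φ (b ∷ c))
    ≡⟨ sym (∑-vecsOver-suc M p (λ c → ∏ (V.map w c) * φ c)) ⟩
  ∑[ c ← vecsOver M (suc p) ] (∏ (V.map w c) * φ c) ∎

-- Counting patterns of fake coins

pilePatterns : (k : ℕ) → List (Vec Bool k)
pilePatterns k = vecsOver (true ∷ false ∷ []) k

-- Stated for every range n > k, so that the induction can use the ranges m and m + 1 at once.
∑-fakesInPile : ∀ k n → k < n → (φ : ℕ → ℕ) →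
                ∑[ x ← pilePatterns k ] φ (fakesInPile x) ≡ ∑[ a ← upTo n ] ((k C a) * φ a)
∑-fakesInPile zero    (suc m) _ φ = begin
  φ 0 + 0
    ≡⟨ cong₂ _+_ (sym (*-identityˡ (φ 0))) (sym (∑-zero (upTo m) (λ _ → refl))) ⟩
  1 * φ 0 + ∑[ a ← upTo m ] ((0 C suc a) * φ (suc a))
    ≡⟨ sym (∑-upTo-suc m (λ a → (0 C a) * φ a)) ⟩
  ∑[ a ← upTo (suc m) ] ((0 C a) * φ a) ∎
∑-fakesInPile (suc k) (suc m) (s≤s k<m) φ = begin
  ∑[ x ← pilePatterns (suc k) ] φ (fakesInPile x)
    ≡⟨ ∑-vecsOver-suc (true ∷ false ∷ []) k (λ x → φ (fakesInPile x)) ⟩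
  ∑[ x ← pilePatterns k ] (φ (suc (fakesInPile x)) + (φ (fakesInPile x) + 0))
    ≡⟨ ∑-cong (pilePatterns k) (λ x → cong (φ (suc (fakesInPile x)) +_) (+-identityʳ _)) ⟩
  ∑[ x ← pilePatterns k ] (φ (suc (fakesInPile x)) + φ (fakesInPile x))
    ≡⟨ ∑-distrib-+ (pilePatterns k) (λ x → φ (suc (fakesInPile x))) (λ x → φ (fakesInPile x)) ⟩
  ∑[ x ← pilePatterns k ] φ (suc (fakesInPile x)) + ∑[ x ← pilePatterns k ] φ (fakesInPile x)
    ≡⟨ cong₂ _+_ (∑-fakesInPile k m k<m (λ a → φ (suc a))) (∑-fakesInPile k (suc m) (m<n⇒m<1+n k<m) φ) ⟩
  A + ∑[ a ← upTo (suc m) ] ((k C a) * φ a)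
    ≡⟨ cong (A +_) (∑-upTo-suc m (λ a → (k C a) * φ a)) ⟩
  A + (1 * φ 0 + B)
    ≡⟨ x+[y+z]≡y+[x+z] A (1 * φ 0) B ⟩
  1 * φ 0 + (A + B)
    ≡⟨ cong (1 * φ 0 +_) (sym (∑-distrib-+ (upTo m) (λ a → (k C a) * φ (suc a)) (λ a → (k C suc a) * φ (suc a)))) ⟩
  1 * φ 0 + ∑[ a ← upTo m ] ((k C a) * φ (suc a) + (k C suc a) * φ (suc a))
    ≡⟨ cong (1 * φ 0 +_) (∑-cong (upTo m) pascal) ⟩
  1 * φ 0 + ∑[ a ← upTo m ] ((suc k C suc a) * φ (suc a))
    ≡⟨ sym (∑-upTo-suc m (λ a → (suc k C a) * φ a)) ⟩
  ∑[ a ← upTo (suc m) ] ((suc k C a) * φ a) ∎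
  where
  A = ∑[ a ← upTo m ] ((k C a) * φ (suc a))
  B = ∑[ a ← upTo m ] ((k C suc a) * φ (suc a))
  pascal : ∀ a → (k C a) * φ (suc a) + (k C suc a) * φ (suc a) ≡ (suc k C suc a) * φ (suc a)
  pascal a = trans (sym (*-distribʳ-+ (φ (suc a)) (k C a) (k C suc a)))
                   (cong (_* φ (suc a)) (nCk+nC[k+1]≡[n+1]C[k+1] k a))

fakesInPile-++ : ∀ {m n} (u : Vec Bool m) (v : Vec Bool n) →
                 fakesInPile (u ++ v) ≡ fakesInPile u + fakesInPile v
fakesInPile-++ []          v = refl
fakesInPile-++ (true ∷ u)  v = cong suc (fakesInPile-++ u v)
fakesInPile-++ (false ∷ u) v = fakesInPile-++ u v

totalFakes≡fakesInPile∘concat : ∀ {p k} (g : Vec (Vec Bool k) p) → totalFakes g ≡ fakesInPile (concat g)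
totalFakes≡fakesInPile∘concat []      = refl
totalFakes≡fakesInPile∘concat (u ∷ g) =
  trans (cong (fakesInPile u +_) (totalFakes≡fakesInPile∘concat g)) (sym (fakesInPile-++ u (concat g)))

oldPossibilities≡ : ∀ p k f → oldPossibilities p k f ≡ (p * k) C f
oldPossibilities≡ p k f = begin
  oldPossibilities p k f
    ≡⟨ length-filter≡∑𝟙 (λ g → totalFakes g ≟ f) (allPossibilities p k) ⟩
  ∑[ g ← allPossibilities p k ] 𝟙 (totalFakes g ≟ f)
    ≡⟨ ∑-cong (allPossibilities p k) (λ g → cong (λ t → 𝟙 (t ≟ f)) (totalFakes≡fakesInPile∘concat g)) ⟩
  ∑[ g ← allPossibilities p k ] 𝟙 (fakesInPile (concat g) ≟ f)
    ≡⟨ ∑-vecsOver-concat (true ∷ false ∷ []) k p (λ x → 𝟙 (fakesInPile x ≟ f)) ⟩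
  ∑[ x ← pilePatterns (p * k) ] 𝟙 (fakesInPile x ≟ f)
    ≡⟨ ∑-fakesInPile (p * k) (suc (p * k)) ≤-refl (λ a → 𝟙 (a ≟ f)) ⟩
  ∑[ a ← upTo (suc (p * k)) ] (((p * k) C a) * 𝟙 (a ≟ f))
    ≡⟨ pickBinomial ⟩
  (p * k) C f ∎
  where
  pickBinomial : ∑[ a ← upTo (suc (p * k)) ] (((p * k) C a) * 𝟙 (a ≟ f)) ≡ (p * k) C f
  pickBinomial with f ≤? p * k
  ... | yes f≤pk = ∑-pick _≟_ (upTo⁺ (suc (p * k))) (∈-upTo⁺ (s≤s f≤pk)) ((p * k) C_)
  ... | no  f≰pk = trans (∑-pick-∉ _≟_ (λ f∈ → f≰pk (s≤s⁻¹ (∈-upTo⁻ f∈))) ((p * k) C_))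
                         (sym (k>n⇒nCk≡0 (≰⇒> f≰pk)))

lookupℕ : ∀ {n} → Vec ℕ n → ℕ → ℕ
lookupℕ []       _       = 0
lookupℕ (x ∷ xs) zero    = x
lookupℕ (x ∷ xs) (suc m) = lookupℕ xs m

lookupℕ-toℕ : ∀ {n} (xs : Vec ℕ n) (i : Fin n) → lookupℕ xs (toℕ i) ≡ lookup xs i
lookupℕ-toℕ (x ∷ xs) fzero    = refl
lookupℕ-toℕ (x ∷ xs) (fsuc i) = lookupℕ-toℕ xs i

lookup-extensionality : ∀ {A : Set} {n} {xs ys : Vec A n} → (∀ i → lookup xs i ≡ lookup ys i) → xs ≡ ys
lookup-extensionality {xs = xs} {ys} eq =
  trans (sym (tabulate∘lookup xs)) (trans (tabulate-cong eq) (tabulate∘lookup ys))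

last≡lookup-fromℕ : ∀ {A : Set} {n} (xs : Vec A (suc n)) → last xs ≡ lookup xs (fromℕ n)
last≡lookup-fromℕ {n = zero}  (x ∷ []) = refl
last≡lookup-fromℕ {n = suc n} (x ∷ xs) = last≡lookup-fromℕ xs

lookup≤last : ∀ {n} (fs : Vec ℕ (suc n)) → StrictlyIncreasing fs → ∀ i → lookup fs i ≤ last fs
lookup≤last {n} fs fs↑ i rewrite last≡lookup-fromℕ fs with m≤n⇒m<n∨m≡n (≤fromℕ i)
... | inj₁ i<n = <⇒≤ (fs↑ i (fromℕ n) i<n)
... | inj₂ i≡n = ≤-reflexive (cong (lookup fs) (toℕ-injective i≡n))

HeightBound⇒lookup≤ : ∀ {n} k (fs : Vec ℕ n) → StrictlyIncreasing fs → HeightBound k fs → ∀ i → lookup fs i ≤ k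
HeightBound⇒lookup≤ {suc n} k fs fs↑ fs≤k i = ≤-trans (lookup≤last fs fs↑ i) fs≤k

lookup≤⇒HeightBound : ∀ {n} k (fs : Vec ℕ n) → (∀ i → lookup fs i ≤ k) → HeightBound k fs
lookup≤⇒HeightBound {zero}  k fs _   = tt
lookup≤⇒HeightBound {suc n} k fs fs≤k = subst (_≤ k) (sym (last≡lookup-fromℕ fs)) (fs≤k (fromℕ n))

0<nCk : ∀ {n k} → k ≤ n → 0 < n C k
0<nCk {n}     {zero}  _         = s≤s z≤n
0<nCk {suc n} {suc k} (s≤s k≤n) =
  subst (0 <_) (nCk+nC[k+1]≡[n+1]C[k+1] n k) (<-≤-trans (0<nCk k≤n) (m≤m+n (n C k) _))

0<∏binomials : ∀ {n} k (c : Vec ℕ n) → (∀ j → lookup c j ≤ k) → 0 < ∏ (V.map (k C_) c)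
0<∏binomials k []      _   = s≤s z≤n
0<∏binomials k (x ∷ c) c≤k = *-mono-< (0<nCk (c≤k fzero)) (0<∏binomials k c (λ j → c≤k (fsuc j)))

-- Possibilities consistent with an outcome

module Outcome {p r : ℕ} (k f : ℕ) (S : Vec ℕ p) (σ : Permutation′ p)
               (S-values : ∀ v → (v < r) ⇔ ∃ (λ i → lookup S i ≡ v)) where

  S<r : ∀ i → lookup S i < r
  S<r i = Equivalence.from (S-values (lookup S i)) (i , refl)

  valueOf : Fin p → Fin r
  valueOf j = fromℕ< (S<r (σ ⟨$⟩ʳ j))

  toℕ-valueOf : ∀ j → toℕ (valueOf j) ≡ entry S σ j
  toℕ-valueOf j = toℕ-fromℕ< (S<r (σ ⟨$⟩ʳ j))

  pileOf : Fin r → Fin p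
  pileOf i = σ ⟨$⟩ˡ proj₁ (Equivalence.to (S-values (toℕ i)) (toℕ<n i))

  entry-pileOf : ∀ i → entry S σ (pileOf i) ≡ toℕ i
  entry-pileOf i = trans (cong (lookup S) (inverseʳ σ)) (proj₂ (Equivalence.to (S-values (toℕ i)) (toℕ<n i)))

  valueOf-pileOf : ∀ i → valueOf (pileOf i) ≡ i
  valueOf-pileOf i = toℕ-injective (trans (toℕ-valueOf (pileOf i)) (entry-pileOf i))

  ConsistentCounts : (Fin p → ℕ) → Set
  ConsistentCounts c = (j j′ : Fin p) →
    (entry S σ j ≡ entry S σ j′ → c j ≡ c j′) × (entry S σ j < entry S σ j′ → c j < c j′)

  consistentCounts? : (c : Vec ℕ p) → Dec (ConsistentCounts (lookup c))
  consistentCounts? c = all? (λ j → all? (λ j′ →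
    ((entry S σ j ≟ entry S σ j′) →-dec (lookup c j ≟ lookup c j′))
    ×-dec ((entry S σ j <? entry S σ j′) →-dec (lookup c j <? lookup c j′))))

  ConsistentCounts-resp : ∀ {c c′} → (∀ j → c j ≡ c′ j) → ConsistentCounts c → ConsistentCounts c′
  ConsistentCounts-resp c≗c′ cons j j′ =
      (λ eq → trans (sym (c≗c′ j)) (trans (proj₁ (cons j j′) eq) (c≗c′ j′)))
    , (λ lt → subst₂ _<_ (c≗c′ j) (c≗c′ j′) (proj₂ (cons j j′) lt))

  IsOutcomeCount : Vec ℕ p → Set
  IsOutcomeCount c = V.sum c ≡ f × ConsistentCounts (lookup c)

  isOutcomeCount? : (c : Vec ℕ p) → Dec (IsOutcomeCount c)
  isOutcomeCount? c = (V.sum c ≟ f) ×-dec consistentCounts? c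

  countVectors : List (Vec ℕ p)
  countVectors = vecsOver (upTo (suc k)) p

  newPossibilities≡∑countVectors :
    newPossibilities k f S σ ≡ ∑[ c ← countVectors ] (∏ (V.map (k C_) c) * 𝟙 (isOutcomeCount? c))
  newPossibilities≡∑countVectors = begin
    newPossibilities k f S σ
      ≡⟨ length-filter≡∑𝟙 (λ g → (totalFakes g ≟ f) ×-dec consistent? S σ g) (allPossibilities p k) ⟩
    ∑[ g ← allPossibilities p k ] 𝟙 ((totalFakes g ≟ f) ×-dec consistent? S σ g)
      ≡⟨ ∑-cong (allPossibilities p k) (λ g → 𝟙-⇔ (outcome⇔ g) ((totalFakes g ≟ f) ×-dec consistent? S σ g)
                                                              (isOutcomeCount? (V.map fakesInPile g))) ⟩
    ∑[ g ← allPossibilities p k ] 𝟙 (isOutcomeCount? (V.map fakesInPile g))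
      ≡⟨ ∑-vecsOver-map (pilePatterns k) fakesInPile (upTo (suc k)) (k C_)
           (∑-fakesInPile k (suc k) ≤-refl) p (λ c → 𝟙 (isOutcomeCount? c)) ⟩
    ∑[ c ← countVectors ] (∏ (V.map (k C_) c) * 𝟙 (isOutcomeCount? c)) ∎
    where
    outcome⇔ : ∀ g → (totalFakes g ≡ f × Consistent S σ g) ⇔ IsOutcomeCount (V.map fakesInPile g)
    outcome⇔ g = mk⇔
      (λ (Σ≡f , cons) → Σ≡f , ConsistentCounts-resp (λ j → sym (lookup-map j fakesInPile g)) cons)
      (λ (Σ≡f , cons) → Σ≡f , ConsistentCounts-resp (λ j → lookup-map j fakesInPile g) cons)

  pileCounts : Vec ℕ r → Vec ℕ p
  pileCounts fs = V.tabulate (λ j → lookup fs (valueOf j))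

  lookup-pileCounts : ∀ fs j → lookup (pileCounts fs) j ≡ lookup fs (valueOf j)
  lookup-pileCounts fs = lookup∘tabulate (λ j → lookup fs (valueOf j))

  lookupℕ-entry : ∀ fs j → lookupℕ fs (entry S σ j) ≡ lookup fs (valueOf j)
  lookupℕ-entry fs j = trans (cong (lookupℕ fs) (sym (toℕ-valueOf j))) (lookupℕ-toℕ fs (valueOf j))

  sum-pileCounts : ∀ fs → V.sum (pileCounts fs) ≡ weightedSum S fs
  sum-pileCounts fs = begin
    V.sum (pileCounts fs)
      ≡⟨ cong V.sum (tabulate-cong (λ j → sym (lookupℕ-entry fs j))) ⟩
    V.sum (V.tabulate (λ j → lookupℕ fs (entry S σ j)))
      ≡⟨ sum-groupByValue S σ S<r (lookupℕ fs) ⟩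
    V.sum (V.tabulate {n = r} (λ i → mult S (toℕ i) * lookupℕ fs (toℕ i)))
      ≡⟨ cong V.sum (tabulate-cong {n = r} (λ i → cong (mult S (toℕ i) *_) (lookupℕ-toℕ fs i))) ⟩
    weightedSum S fs ∎

  ∏-pileCounts : ∀ fs → ∏ (V.map (k C_) (pileCounts fs)) ≡ solutionWeight S k fs
  ∏-pileCounts fs = begin
    ∏ (V.map (k C_) (pileCounts fs))
      ≡⟨ cong ∏ (sym (tabulate-∘ (k C_) (λ j → lookup fs (valueOf j)))) ⟩
    ∏ (V.tabulate (λ j → k C lookup fs (valueOf j)))
      ≡⟨ cong ∏ (tabulate-cong (λ j → cong (k C_) (sym (lookupℕ-entry fs j)))) ⟩
    ∏ (V.tabulate (λ j → k C lookupℕ fs (entry S σ j)))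
      ≡⟨ ∏-groupByValue S σ S<r (λ n → k C lookupℕ fs n) ⟩
    ∏ (V.tabulate {n = r} (λ i → (k C lookupℕ fs (toℕ i)) ^ mult S (toℕ i)))
      ≡⟨ cong ∏ (tabulate-cong {n = r} (λ i → cong (λ v → (k C v) ^ mult S (toℕ i)) (lookupℕ-toℕ fs i))) ⟩
    solutionWeight S k fs ∎

  pileCounts-injective : ∀ {fs fs′} → pileCounts fs ≡ pileCounts fs′ → fs ≡ fs′
  pileCounts-injective {fs} {fs′} eq = lookup-extensionality λ i → begin
    lookup fs i                          ≡⟨ cong (lookup fs) (valueOf-pileOf i) ⟨
    lookup fs (valueOf (pileOf i))       ≡⟨ lookup-pileCounts fs (pileOf i) ⟨
    lookup (pileCounts fs) (pileOf i)    ≡⟨ cong (λ c → lookup c (pileOf i)) eq ⟩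
    lookup (pileCounts fs′) (pileOf i)   ≡⟨ lookup-pileCounts fs′ (pileOf i) ⟩
    lookup fs′ (valueOf (pileOf i))      ≡⟨ cong (lookup fs′) (valueOf-pileOf i) ⟩
    lookup fs′ i                         ∎

  pileCounts-isOutcomeCount : ∀ {fs} → IsGeneralSolution S f fs → IsOutcomeCount (pileCounts fs)
  pileCounts-isOutcomeCount {fs} (fs↑ , Σ≡f) =
    trans (sum-pileCounts fs) Σ≡f ,
    ConsistentCounts-resp (λ j → sym (lookup-pileCounts fs j)) λ j j′ →
        (λ eq → cong (lookup fs) (toℕ-injective (trans (toℕ-valueOf j) (trans eq (sym (toℕ-valueOf j′))))))
      , (λ lt → fs↑ (valueOf j) (valueOf j′) (subst₂ _<_ (sym (toℕ-valueOf j)) (sym (toℕ-valueOf j′)) lt))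

  lookup-pileCounts≤ : ∀ {fs} → StrictlyIncreasing fs → HeightBound k fs → ∀ j → lookup (pileCounts fs) j ≤ k
  lookup-pileCounts≤ {fs} fs↑ fs≤k j =
    subst (_≤ k) (sym (lookup-pileCounts fs j)) (HeightBound⇒lookup≤ k fs fs↑ fs≤k (valueOf j))

  solutionOf : Vec ℕ p → Vec ℕ r
  solutionOf c = V.tabulate (λ i → lookup c (pileOf i))

  outcomeCount⇒solution : ∀ {c} → c ∈ countVectors → IsOutcomeCount c →
    (IsGeneralSolution S f (solutionOf c) × HeightBound k (solutionOf c)) × c ≡ pileCounts (solutionOf c)
  outcomeCount⇒solution {c} c∈ (Σ≡f , cons) = ((solution↑ , weightedSum≡f) , heightBound) , c≡
    where
    lookup-solutionOf : ∀ i → lookup (solutionOf c) i ≡ lookup c (pileOf i)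
    lookup-solutionOf = lookup∘tabulate (λ i → lookup c (pileOf i))

    c≡ : c ≡ pileCounts (solutionOf c)
    c≡ = lookup-extensionality λ j → sym (begin
      lookup (pileCounts (solutionOf c)) j   ≡⟨ lookup-pileCounts (solutionOf c) j ⟩
      lookup (solutionOf c) (valueOf j)      ≡⟨ lookup-solutionOf (valueOf j) ⟩
      lookup c (pileOf (valueOf j))          ≡⟨ proj₁ (cons (pileOf (valueOf j)) j) (trans (entry-pileOf (valueOf j)) (toℕ-valueOf j)) ⟩
      lookup c j                             ∎)

    solution↑ : StrictlyIncreasing (solutionOf c)
    solution↑ i i′ lt = subst₂ _<_ (sym (lookup-solutionOf i)) (sym (lookup-solutionOf i′))
      (proj₂ (cons (pileOf i) (pileOf i′)) (subst₂ _<_ (sym (entry-pileOf i)) (sym (entry-pileOf i′)) lt))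

    weightedSum≡f : weightedSum S (solutionOf c) ≡ f
    weightedSum≡f = trans (sym (sum-pileCounts (solutionOf c))) (trans (cong V.sum (sym c≡)) Σ≡f)

    heightBound : HeightBound k (solutionOf c)
    heightBound = lookup≤⇒HeightBound k (solutionOf c) λ i →
      subst (_≤ k) (sym (lookup-solutionOf i)) (s≤s⁻¹ (∈-upTo⁻ (∈-vecsOver⁻ (upTo (suc k)) c∈ (pileOf i))))

  module _ (𝓕 : List (Vec ℕ r)) (𝓕! : Unique 𝓕)
           (𝓕-spec : ∀ fs → (fs ∈ 𝓕) ⇔ (IsGeneralSolution S f fs × HeightBound k fs)) where

    newPossibilities≡∑solutionWeight : newPossibilities k f S σ ≡ ∑[ fs ← 𝓕 ] solutionWeight S k fs
    newPossibilities≡∑solutionWeight = begin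
      newPossibilities k f S σ
        ≡⟨ newPossibilities≡∑countVectors ⟩
      ∑[ c ← countVectors ] (∏ (V.map (k C_) c) * 𝟙 (isOutcomeCount? c))
        ≡⟨ ∑-filter-bijection (≡-dec _≟_) (≡-dec _≟_) isOutcomeCount? pileCounts (λ c → ∏ (V.map (k C_) c))
             (vecsOver-unique (upTo⁺ (suc k)) p) 𝓕! pileCounts-injective into onto ⟩
      ∑[ fs ← 𝓕 ] ∏ (V.map (k C_) (pileCounts fs))
        ≡⟨ ∑-cong 𝓕 ∏-pileCounts ⟩
      ∑[ fs ← 𝓕 ] solutionWeight S k fs ∎
      where
      into : ∀ {fs} → fs ∈ 𝓕 → pileCounts fs ∈ countVectors × IsOutcomeCount (pileCounts fs)
      into {fs} fs∈ with (fs↑ , Σ≡f) , fs≤k ← Equivalence.to (𝓕-spec fs) fs∈ =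
          ∈-vecsOver⁺ (upTo (suc k)) (λ j → ∈-upTo⁺ (s≤s (lookup-pileCounts≤ {fs} fs↑ fs≤k j)))
        , pileCounts-isOutcomeCount {fs} (fs↑ , Σ≡f)
      onto : ∀ {c} → c ∈ countVectors → IsOutcomeCount c → ∃[ fs ] fs ∈ 𝓕 × c ≡ pileCounts fs
      onto c∈ outcome with solution , c≡ ← outcomeCount⇒solution c∈ outcome =
        _ , Equivalence.from (𝓕-spec _) solution , c≡

    0<∑solutionWeight : 𝓕 ≢ [] → 0 < ∑[ fs ← 𝓕 ] solutionWeight S k fs
    0<∑solutionWeight 𝓕≢[] = 0<∑ 𝓕 𝓕≢[] λ {fs} fs∈ →
      let (fs↑ , _) , fs≤k = Equivalence.to (𝓕-spec fs) fs∈
      in subst (0 <_) (∏-pileCounts fs) (0<∏binomials k (pileCounts fs) (lookup-pileCounts≤ {fs} fs↑ fs≤k))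

ratio-agree : ∀ {a a′ n n′} → a ≡ a′ → n ≡ n′ → 0 < n′ →
              Σ ℚ (λ X → ratio a n ≡ just X × ratio a′ n′ ≡ just X)
ratio-agree {n′ = suc _} refl refl _ = _ , refl , refl

mainTheorem11 : (p r k f : ℕ) (S : Vec ℕ p) (σ : Permutation′ p) →
    IsSortingSeq S →
    (∀ v → (v < r) ⇔ ∃ (λ i → lookup S i ≡ v)) →
    r > 1 → 1 ≤ k →
    (𝓕 : List (Vec ℕ r)) → Unique 𝓕 →
    (∀ fs → (fs ∈ 𝓕) ⇔ (IsGeneralSolution S f fs × HeightBound k fs)) →
    𝓕 ≢ [] →
    Σ ℚ (λ X → revealingFactor k f S σ ≡ just X
             × ratio ((p * k) C f) (sum (map (solutionWeight S k) 𝓕)) ≡ just X)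
mainTheorem11 p r k f S σ _ S-values _ _ 𝓕 𝓕! 𝓕-spec 𝓕≢[] =
  ratio-agree (oldPossibilities≡ p k f) (newPossibilities≡∑solutionWeight 𝓕 𝓕! 𝓕-spec)
              (0<∑solutionWeight 𝓕 𝓕! 𝓕-spec 𝓕≢[])
  where open Outcome k f S σ S-values
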